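{- Let $\nu\ge1$ and $0\le j\le 2\nu+1$ be integers. Then $$\sum_{\mu=0}^{\nu}\frac{(-1)^\mu}{\mu-j+\frac12}\binom{4\nu-2\mu+1}{2\nu-\mu,\ \mu,\ 2\nu-2\mu+1}=2^{4\nu+2}(-1)^j\frac{(2\nu-j+1)!\,j!}{(2j)!\,(2\nu-2j+2)!},$$ where $\binom{N}{a,b,c}=\frac{N!}{a!\,b!\,c!}$ is the multinomial coefficient, and $1/k!:=1/\Gamma(k+1)=0$ for negative integers $k$ (so the right side is $0$ when $j>\nu+1$). -}

module Defs where

open import Data.Nat as ℕ using (ℕ; zero; suc; _!)
open import Data.Nat.Properties using (_!≢0)
open import Data.Integer as ℤ using (ℤ; +_; -[1+_])
open import Data.Rational as ℚ using (ℚ; _/_)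

-- Reciprocal factorial  1/k! := 1/Γ(k+1), which is 0 for negative integers k.
recipFact : ℤ → ℚ
recipFact (+ n)     = _/_ (+ 1) (n !) ⦃ n !≢0 ⦄
recipFact -[1+ n ]  = ℚ.0ℚ

factℚ : ℕ → ℚ
factℚ n = (+ (n !)) / 1

multinom : ℕ → ℕ → ℕ → ℕ → ℚ
multinom N a b c = factℚ N ℚ.* recipFact (+ a) ℚ.* recipFact (+ b) ℚ.* recipFact (+ c)

-- The rational number  1 / (k + 1/2)  for an integer k (never a division by zero).
-- For k = n ≥ 0:      1/(n + 1/2)   = 2/(2n+1).
-- For k = -(n+1) < 0: 1/(-n - 1/2)  = -2/(2n+1).
recipHalfShift : ℤ → ℚ
recipHalfShift (+ n)    = (+ 2) / (suc (2 ℕ.* n))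
recipHalfShift -[1+ n ] = ℤ.- (+ 2) / (suc (2 ℕ.* n))

signℚ : ℕ → ℚ
signℚ zero    = ℚ.1ℚ
signℚ (suc k) = ℚ.- signℚ k

sumTo : ℕ → (ℕ → ℚ) → ℚ
sumTo zero    f = f zero
sumTo (suc ν) f = sumTo ν f ℚ.+ f (suc ν)

{-# OPTIONS --safe #-}
-- Both sides, as functions of j for fixed ν, satisfy the first-order recurrence
--   c₀(ν,j) f(j) + c₁(ν,j) f(j+1) = 0,   c₀ = −(ν−j+1)(2ν−2j+1),   c₁ = −(2j+1)(2ν−j+1).
-- For the sum this is Zeilberger's method: c₀ t(j,μ) + c₁ t(j+1,μ) telescopes in μ against the
-- certificate G(μ) = −(−1)^μ A(ν,μ) (2ν−2μ+1)(ν−μ) / (μ−j+½), which vanishes at μ = ν; for the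
-- closed form it is a direct check, using 1/k! = 0 for k < 0 once j > ν.  As c₁ ≠ 0 for j ≤ 2ν,
-- everything reduces to j = 0.  There a second telescoping argument, now in ν, gives
-- (ν+2) S(ν+1) = 16(ν+1) S(ν); the closed form 2^(4ν+2)/(2ν+2) obeys the same recurrence,
-- and both sides equal 2 at ν = 0.
module Submission where

open import Agda.Builtin.FromNat using (fromNat)
open import Data.Integer as ℤ using (ℤ; +_; -[1+_])
import Data.Integer.Properties as ℤP
open import Data.Integer.Tactic.RingSolver using () renaming (solve-∀ to solve-∀ℤ)
open import Data.Maybe using (Maybe; just; nothing)
open import Data.Nat as ℕ using (ℕ; zero; suc; _≤_; _!)
import Data.Nat.Literals as ℕLiterals
import Data.Nat.Properties as ℕP
open import Data.Nat.Properties using (_!≢0)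
open import Data.Nat.Tactic.RingSolver using () renaming (solve-∀ to solve-∀ℕ)
open import Data.Rational as ℚ using (ℚ; _/_; 0ℚ; 1ℚ)
import Data.Rational.Literals as ℚLiterals
import Data.Rational.Properties as ℚP
open import Algebra.Properties.Group ℚP.+-0-group using () renaming (∙-cancelˡ to +-cancelˡ)
open import Data.Rational.Properties
  using (_≟_; +-*-commutativeRing; toℚᵘ-injective; toℚᵘ-fromℚᵘ; toℚᵘ-homo-+; toℚᵘ-homo-*; toℚᵘ-homo‿-)
open import Data.Rational.Unnormalised as ℚᵘ using (mkℚᵘ; *≡*)
import Data.Rational.Unnormalised.Properties as ℚᵘP
open import Data.Sum using (inj₁; inj₂)
open import Data.Unit using (tt)
open import Level using (0ℓ)
open import Relation.Binary.PropositionalEquality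
  using (_≡_; refl; sym; trans; cong; cong₂; subst; module ≡-Reasoning)
open import Relation.Nullary using (yes; no)
open import Tactic.RingSolver using (solve-∀)
open import Tactic.RingSolver.Core.AlmostCommutativeRing using (AlmostCommutativeRing; fromCommutativeRing)

open import Defs

instance
  ℕ-number = ℕLiterals.number
  ℚ-number = ℚLiterals.number
  trivial  = tt

module _ where
  open import Data.Rational using (_+_; _*_; _-_; -_)

  ℚ-ring : AlmostCommutativeRing 0ℓ 0ℓ
  ℚ-ring = fromCommutativeRing +-*-commutativeRing 0≟
    where
    0≟ : ∀ p → Maybe (0ℚ ≡ p)
    0≟ p with 0ℚ ≟ p
    ... | yes 0≡p = just 0≡p
    ... | no _    = nothing

  fromℤ : ℤ → ℚ
  fromℤ i = i / 1

  fromℕ : ℕ → ℚ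
  fromℕ n = fromℤ (+ n)

  toℚᵘ-fromℤ : ∀ i → ℚ.toℚᵘ (fromℤ i) ℚᵘ.≃ mkℚᵘ i 0
  toℚᵘ-fromℤ i = toℚᵘ-fromℚᵘ (mkℚᵘ i 0)

  fromℤ-+ : ∀ i j → fromℤ (i ℤ.+ j) ≡ fromℤ i + fromℤ j
  fromℤ-+ i j = toℚᵘ-injective (begin
    ℚ.toℚᵘ (fromℤ (i ℤ.+ j))                ≈⟨ toℚᵘ-fromℤ (i ℤ.+ j) ⟩
    mkℚᵘ (i ℤ.+ j) 0                        ≈⟨ *≡* (+-over-1 i j) ⟩
    mkℚᵘ i 0 ℚᵘ.+ mkℚᵘ j 0                  ≈⟨ ℚᵘP.+-cong (ℚᵘP.≃-sym (toℚᵘ-fromℤ i)) (ℚᵘP.≃-sym (toℚᵘ-fromℤ j)) ⟩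
    ℚ.toℚᵘ (fromℤ i) ℚᵘ.+ ℚ.toℚᵘ (fromℤ j) ≈⟨ ℚᵘP.≃-sym (toℚᵘ-homo-+ (fromℤ i) (fromℤ j)) ⟩
    ℚ.toℚᵘ (fromℤ i + fromℤ j)              ∎)
    where
    open ℚᵘP.≃-Reasoning
    +-over-1 : ∀ i j → (i ℤ.+ j) ℤ.* + 1 ≡ (i ℤ.* + 1 ℤ.+ j ℤ.* + 1) ℤ.* + 1
    +-over-1 = solve-∀ℤ

  fromℤ-* : ∀ i j → fromℤ (i ℤ.* j) ≡ fromℤ i * fromℤ j
  fromℤ-* i j = toℚᵘ-injective (begin
    ℚ.toℚᵘ (fromℤ (i ℤ.* j))                ≈⟨ toℚᵘ-fromℤ (i ℤ.* j) ⟩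
    mkℚᵘ i 0 ℚᵘ.* mkℚᵘ j 0                  ≈⟨ ℚᵘP.*-cong (ℚᵘP.≃-sym (toℚᵘ-fromℤ i)) (ℚᵘP.≃-sym (toℚᵘ-fromℤ j)) ⟩
    ℚ.toℚᵘ (fromℤ i) ℚᵘ.* ℚ.toℚᵘ (fromℤ j) ≈⟨ ℚᵘP.≃-sym (toℚᵘ-homo-* (fromℤ i) (fromℤ j)) ⟩
    ℚ.toℚᵘ (fromℤ i * fromℤ j)              ∎)
    where open ℚᵘP.≃-Reasoning

  fromℤ-neg : ∀ i → fromℤ (ℤ.- i) ≡ - fromℤ i
  fromℤ-neg i = toℚᵘ-injective (begin
    ℚ.toℚᵘ (fromℤ (ℤ.- i))  ≈⟨ toℚᵘ-fromℤ (ℤ.- i) ⟩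
    ℚᵘ.- mkℚᵘ i 0           ≈⟨ ℚᵘP.-‿cong (ℚᵘP.≃-sym (toℚᵘ-fromℤ i)) ⟩
    ℚᵘ.- ℚ.toℚᵘ (fromℤ i)   ≈⟨ ℚᵘP.≃-sym (toℚᵘ-homo‿- (fromℤ i)) ⟩
    ℚ.toℚᵘ (- fromℤ i)      ∎)
    where open ℚᵘP.≃-Reasoning

  fromℕ-+ : ∀ m n → fromℕ (m ℕ.+ n) ≡ fromℕ m + fromℕ n
  fromℕ-+ m n = trans (cong fromℤ (ℤP.pos-+ m n)) (fromℤ-+ (+ m) (+ n))

  fromℕ-* : ∀ m n → fromℕ (m ℕ.* n) ≡ fromℕ m * fromℕ n
  fromℕ-* m n = trans (cong fromℤ (ℤP.pos-* m n)) (fromℤ-* (+ m) (+ n))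

  fromℕ-suc : ∀ n → fromℕ (suc n) ≡ 1 + fromℕ n
  fromℕ-suc = fromℕ-+ 1

  fromℕ-- : ∀ m n → fromℤ (+ m ℤ.- + n) ≡ fromℕ m - fromℕ n
  fromℕ-- m n = trans (fromℤ-+ (+ m) (ℤ.- + n)) (cong (_+_ (fromℕ m)) (fromℤ-neg (+ n)))

  /-*-cancel : ∀ i n .{{_ : ℕ.NonZero n}} → (i / n) * fromℕ n ≡ fromℤ i
  /-*-cancel i (suc d) = toℚᵘ-injective (begin
    ℚ.toℚᵘ ((i / suc d) * fromℕ (suc d))            ≈⟨ toℚᵘ-homo-* (i / suc d) (fromℕ (suc d)) ⟩
    ℚ.toℚᵘ (i / suc d) ℚᵘ.* ℚ.toℚᵘ (fromℕ (suc d))  ≈⟨ ℚᵘP.*-cong (toℚᵘ-fromℚᵘ (mkℚᵘ i d)) (toℚᵘ-fromℤ (+ suc d)) ⟩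
    mkℚᵘ i d ℚᵘ.* mkℚᵘ (+ suc d) 0                  ≈⟨ *≡* (cancel i d) ⟩
    mkℚᵘ i 0                                        ≈⟨ ℚᵘP.≃-sym (toℚᵘ-fromℤ i) ⟩
    ℚ.toℚᵘ (fromℤ i)                                ∎)
    where
    open ℚᵘP.≃-Reasoning
    cancel : ∀ i d → (i ℤ.* + suc d) ℤ.* + 1 ≡ i ℤ.* + suc (d ℕ.* 1)
    cancel i d = trans (ℤP.*-identityʳ _) (cong (λ e → i ℤ.* + suc e) (sym (ℕP.*-identityʳ d)))

  fromℕ-suc-cancelˡ : ∀ n {p q} → fromℕ (suc n) * p ≡ fromℕ (suc n) * q → p ≡ q
  fromℕ-suc-cancelˡ n {p} {q} eq = begin
    p                             ≡⟨ unit p ⟨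
    (w * fromℕ (suc n)) * p       ≡⟨ ℚP.*-assoc w _ p ⟩
    w * (fromℕ (suc n) * p)       ≡⟨ cong (w *_) eq ⟩
    w * (fromℕ (suc n) * q)       ≡⟨ ℚP.*-assoc w _ q ⟨
    (w * fromℕ (suc n)) * q       ≡⟨ unit q ⟩
    q                             ∎
    where
    open ≡-Reasoning
    w = + 1 / suc n
    unit : ∀ r → (w * fromℕ (suc n)) * r ≡ r
    unit r = trans (cong (_* r) (/-*-cancel (+ 1) (suc n))) (ℚP.*-identityˡ r)

  cong₃ : ∀ {A B C D : Set} (f : A → B → C → D) {x x′ y y′ z z′} → x ≡ x′ → y ≡ y′ → z ≡ z′ → f x y z ≡ f x′ y′ z′
  cong₃ f refl refl refl = refl

  ∸-shape : ∀ {x} y {z} → x ≡ y ℕ.+ z → x ℕ.∸ y ≡ z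
  ∸-shape y {z} refl = ℕP.m+n∸m≡n y z

  ℤ-sub-shape : ∀ {x} y d → x ≡ y ℕ.+ d → + x ℤ.- + y ≡ + d
  ℤ-sub-shape y d refl = begin
    + (y ℕ.+ d) ℤ.- + y    ≡⟨ ℤP.m-n≡m⊖n (y ℕ.+ d) y ⟩
    (y ℕ.+ d) ℤ.⊖ y        ≡⟨ ℤP.⊖-≥ (ℕP.m≤m+n y d) ⟩
    + (y ℕ.+ d ℕ.∸ y)      ≡⟨ cong +_ (ℕP.m+n∸m≡n y d) ⟩
    + d                    ∎
    where open ≡-Reasoning

  2[1+k]≡2+2k : ∀ k → 2 ℕ.* suc k ≡ 2 ℕ.+ 2 ℕ.* k
  2[1+k]≡2+2k = solve-∀ℕ

  2[1+k]+1≡3+2k : ∀ k → 2 ℕ.* suc k ℕ.+ 1 ≡ 3 ℕ.+ 2 ℕ.* k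
  2[1+k]+1≡3+2k = solve-∀ℕ

  infixl 6 _⊕_
  infixl 7 _⊗_

  data Expr : Set where
    ⌜_⌝     : ℕ → Expr
    _⊕_ _⊗_ : Expr → Expr → Expr

  ⟦_⟧ℕ : Expr → ℕ
  ⟦ ⌜ n ⌝ ⟧ℕ = n
  ⟦ e ⊕ f ⟧ℕ = ⟦ e ⟧ℕ ℕ.+ ⟦ f ⟧ℕ
  ⟦ e ⊗ f ⟧ℕ = ⟦ e ⟧ℕ ℕ.* ⟦ f ⟧ℕ

  ⟦_⟧ℚ : Expr → ℚ
  ⟦ ⌜ n ⌝ ⟧ℚ = fromℕ n
  ⟦ e ⊕ f ⟧ℚ = ⟦ e ⟧ℚ + ⟦ f ⟧ℚ
  ⟦ e ⊗ f ⟧ℚ = ⟦ e ⟧ℚ * ⟦ f ⟧ℚ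

  fromℕ-⟦⟧ : ∀ e → fromℕ ⟦ e ⟧ℕ ≡ ⟦ e ⟧ℚ
  fromℕ-⟦⟧ ⌜ n ⌝   = refl
  fromℕ-⟦⟧ (e ⊕ f) = trans (fromℕ-+ ⟦ e ⟧ℕ ⟦ f ⟧ℕ) (cong₂ _+_ (fromℕ-⟦⟧ e) (fromℕ-⟦⟧ f))
  fromℕ-⟦⟧ (e ⊗ f) = trans (fromℕ-* ⟦ e ⟧ℕ ⟦ f ⟧ℕ) (cong₂ _*_ (fromℕ-⟦⟧ e) (fromℕ-⟦⟧ f))

  factor-out : ∀ e {x y z} → x ≡ fromℕ ⟦ e ⟧ℕ * y → y ≡ z → x ≡ ⟦ e ⟧ℚ * z
  factor-out e x≡ey y≡z = trans x≡ey (cong₂ _*_ (fromℕ-⟦⟧ e) y≡z)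

  infixr 4 factor-out
  syntax factor-out e x≡ey y≡z = x≡ey ∙⟨ e ⟩ y≡z

  factℚ-suc : ∀ n → factℚ (suc n) ≡ fromℕ (suc n) * factℚ n
  factℚ-suc n = fromℕ-* (suc n) (n !)

  recipFact-inverse : ∀ n → recipFact (+ n) * factℚ n ≡ 1ℚ
  recipFact-inverse n = /-*-cancel (+ 1) (n !) {{n !≢0}}

  recipFact-suc : ∀ n → recipFact (+ n) ≡ fromℕ (suc n) * recipFact (+ suc n)
  recipFact-suc n = begin
    r                                      ≡⟨ ℚP.*-identityʳ r ⟨
    r * 1ℚ                                 ≡⟨ cong (r *_) (trans (ℚP.*-comm _ r′) (recipFact-inverse (suc n))) ⟨
    r * (factℚ (suc n) * r′)               ≡⟨ cong (λ f → r * (f * r′)) (factℚ-suc n) ⟩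
    r * (fromℕ (suc n) * factℚ n * r′)     ≡⟨ regroup r (fromℕ (suc n)) (factℚ n) r′ ⟩
    r * factℚ n * (fromℕ (suc n) * r′)     ≡⟨ cong (_* (fromℕ (suc n) * r′)) (recipFact-inverse n) ⟩
    1ℚ * (fromℕ (suc n) * r′)              ≡⟨ ℚP.*-identityˡ _ ⟩
    fromℕ (suc n) * r′                     ∎
    where
    open ≡-Reasoning
    r  = recipFact (+ n)
    r′ = recipFact (+ suc n)
    regroup : ∀ r a f r′ → r * (a * f * r′) ≡ r * f * (a * r′)
    regroup = solve-∀ ℚ-ring

  multinom-suc : ∀ N a b c → multinom (suc N) a b c ≡ fromℕ (suc N) * multinom N a b c
  multinom-suc N a b c = trans (cong (λ f → f * recipFact (+ a) * recipFact (+ b) * recipFact (+ c)) (factℚ-suc N))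
                               (regroup (fromℕ (suc N)) (factℚ N) (recipFact (+ a)) (recipFact (+ b)) (recipFact (+ c)))
    where
    regroup : ∀ x f p q r → x * f * p * q * r ≡ x * (f * p * q * r)
    regroup = solve-∀ ℚ-ring

  multinom-suc₁ : ∀ N a b c → multinom N a b c ≡ fromℕ (suc a) * multinom N (suc a) b c
  multinom-suc₁ N a b c = trans (cong (λ r → factℚ N * r * recipFact (+ b) * recipFact (+ c)) (recipFact-suc a))
                                (regroup (factℚ N) (fromℕ (suc a)) (recipFact (+ suc a)) (recipFact (+ b)) (recipFact (+ c)))
    where
    regroup : ∀ f x p q r → f * (x * p) * q * r ≡ x * (f * p * q * r)
    regroup = solve-∀ ℚ-ring

  multinom-suc₂ : ∀ N a b c → multinom N a b c ≡ fromℕ (suc b) * multinom N a (suc b) c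
  multinom-suc₂ N a b c = trans (cong (λ r → factℚ N * recipFact (+ a) * r * recipFact (+ c)) (recipFact-suc b))
                                (regroup (factℚ N) (fromℕ (suc b)) (recipFact (+ a)) (recipFact (+ suc b)) (recipFact (+ c)))
    where
    regroup : ∀ f x p q r → f * p * (x * q) * r ≡ x * (f * p * q * r)
    regroup = solve-∀ ℚ-ring

  multinom-suc₃ : ∀ N a b c → multinom N a b c ≡ fromℕ (suc c) * multinom N a b (suc c)
  multinom-suc₃ N a b c = trans (cong (λ r → factℚ N * recipFact (+ a) * recipFact (+ b) * r) (recipFact-suc c))
                                (regroup (factℚ N) (fromℕ (suc c)) (recipFact (+ a)) (recipFact (+ b)) (recipFact (+ suc c)))
    where
    regroup : ∀ f x p q r → f * p * q * (x * r) ≡ x * (f * p * q * r)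
    regroup = solve-∀ ℚ-ring

  fromℕ-odd : ∀ n → fromℕ (suc (2 ℕ.* n)) ≡ 2 * fromℕ n + 1
  fromℕ-odd n = trans (fromℕ-⟦⟧ (⌜ 1 ⌝ ⊕ ⌜ 2 ⌝ ⊗ ⌜ n ⌝)) (ℚP.+-comm 1 (2 * fromℕ n))

  recipHalfShift-inverse : ∀ z → recipHalfShift z * (2 * fromℤ z + 1) ≡ 2
  recipHalfShift-inverse (+ n) = begin
    recipHalfShift (+ n) * (2 * fromℕ n + 1)         ≡⟨ cong (recipHalfShift (+ n) *_) (fromℕ-odd n) ⟨
    recipHalfShift (+ n) * fromℕ (suc (2 ℕ.* n))     ≡⟨ /-*-cancel (+ 2) (suc (2 ℕ.* n)) ⟩
    2                                                ∎
    where open ≡-Reasoning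
  recipHalfShift-inverse -[1+ n ] = begin
    x * (2 * - fromℕ (suc n) + 1)                    ≡⟨ cong (λ y → x * (2 * - y + 1)) (fromℕ-⟦⟧ (⌜ 1 ⌝ ⊕ ⌜ n ⌝)) ⟩
    x * (2 * - (1 + fromℕ n) + 1)                    ≡⟨ negate x (fromℕ n) ⟩
    - (x * (2 * fromℕ n + 1))                        ≡⟨ cong (λ y → - (x * y)) (fromℕ-odd n) ⟨
    - (x * fromℕ (suc (2 ℕ.* n)))                    ≡⟨ cong -_ (/-*-cancel (ℤ.- + 2) (suc (2 ℕ.* n))) ⟩
    2                                                ∎
    where
    open ≡-Reasoning
    x = recipHalfShift -[1+ n ]
    negate : ∀ x n → x * (2 * - (1 + n) + 1) ≡ - (x * (2 * n + 1))
    negate = solve-∀ ℚ-ring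

  recipHalfShift-diff : ∀ m j → recipHalfShift (+ m ℤ.- + j) * (2 * (fromℕ m - fromℕ j) + 1) ≡ 2
  recipHalfShift-diff m j =
    trans (cong (λ d → recipHalfShift (+ m ℤ.- + j) * (2 * d + 1)) (sym (fromℕ-- m j)))
          (recipHalfShift-inverse (+ m ℤ.- + j))

  recipHalfShift-diff-suc : ∀ m j → recipHalfShift (+ m ℤ.- + suc j) * (2 * (fromℕ m - (1 + fromℕ j)) + 1) ≡ 2
  recipHalfShift-diff-suc m j =
    trans (cong (λ y → recipHalfShift (+ m ℤ.- + suc j) * (2 * (fromℕ m - y) + 1)) (sym (fromℕ-suc j)))
          (recipHalfShift-diff m (suc j))

  recipHalfShift-suc : ∀ m → recipHalfShift (+ suc m ℤ.- + 0) * (2 * (1 + fromℕ m) + 1) ≡ 2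
  recipHalfShift-suc m = subst (λ x → recipHalfShift (+ suc m ℤ.- + 0) * (2 * x + 1) ≡ 2)
                               (trans (ℚP.+-identityʳ (fromℕ (suc m))) (fromℕ-suc m))
                               (recipHalfShift-diff (suc m) 0)

  recipHalfShift-shift : ∀ m j → recipHalfShift (+ suc m ℤ.- + suc j) ≡ recipHalfShift (+ m ℤ.- + j)
  recipHalfShift-shift m j = cong recipHalfShift (begin
    + suc m ℤ.- + suc j  ≡⟨ ℤP.m-n≡m⊖n (suc m) (suc j) ⟩
    suc m ℤ.⊖ suc j      ≡⟨ ℤP.[1+m]⊖[1+n]≡m⊖n m j ⟩
    m ℤ.⊖ j              ≡⟨ ℤP.m-n≡m⊖n m j ⟨
    + m ℤ.- + j          ∎)
    where open ≡-Reasoning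

  sumTo-linear : ∀ n (f g : ℕ → ℚ) a b → sumTo n (λ μ → a * f μ + b * g μ) ≡ a * sumTo n f + b * sumTo n g
  sumTo-linear zero    f g a b = refl
  sumTo-linear (suc n) f g a b =
    trans (cong (_+ (a * f (suc n) + b * g (suc n))) (sumTo-linear n f g a b))
          (distrib a b (sumTo n f) (sumTo n g) (f (suc n)) (g (suc n)))
    where
    distrib : ∀ a b x y u v → a * x + b * y + (a * u + b * v) ≡ a * (x + u) + b * (y + v)
    distrib = solve-∀ ℚ-ring

  sumTo-telescope : ∀ n (u G : ℕ → ℚ) → u 0 ≡ G 0 → (∀ m → suc m ≤ n → u (suc m) ≡ G (suc m) - G m) →
                    sumTo n u ≡ G n
  sumTo-telescope zero    u G u₀ uₛ = u₀
  sumTo-telescope (suc n) u G u₀ uₛ =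
    trans (cong₂ _+_ (sumTo-telescope n u G u₀ (λ m m<n → uₛ m (ℕP.m≤n⇒m≤1+n m<n))) (uₛ n ℕP.≤-refl))
          (cancel (G n) (G (suc n)))
    where
    cancel : ∀ x y → x + (y - x) ≡ y
    cancel = solve-∀ ℚ-ring

  coeff : ℕ → ℕ → ℚ
  coeff ν μ = multinom (4 ℕ.* ν ℕ.∸ 2 ℕ.* μ ℕ.+ 1) (2 ℕ.* ν ℕ.∸ μ) μ (2 ℕ.* ν ℕ.∸ 2 ℕ.* μ ℕ.+ 1)

  summand : ℕ → ℕ → ℕ → ℚ
  summand ν j μ = signℚ μ * recipHalfShift (+ μ ℤ.- + j) * coeff ν μ

  lhs : ℕ → ℕ → ℚ
  lhs ν j = sumTo ν (summand ν j)

  rhs : ℕ → ℕ → ℚ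
  rhs ν j = (+ (2 ℕ.^ (4 ℕ.* ν ℕ.+ 2))) / 1 * signℚ j * factℚ (2 ℕ.* ν ℕ.∸ j ℕ.+ 1) * factℚ j
            * recipFact (+ (2 ℕ.* j)) * recipFact (+ (2 ℕ.* ν ℕ.+ 2) ℤ.- + (2 ℕ.* j))

  coeff-shape : ∀ {ν N a c} μ k → μ ℕ.+ k ≡ ν → 2 ℕ.* μ ℕ.+ 4 ℕ.* k ℕ.+ 1 ≡ N → μ ℕ.+ 2 ℕ.* k ≡ a →
                2 ℕ.* k ℕ.+ 1 ≡ c → coeff ν μ ≡ multinom N a μ c
  coeff-shape μ k refl refl refl refl = multinom-cong μ
    (cong (ℕ._+ 1) (∸-shape (2 ℕ.* μ) (split₄ μ k)))
    (∸-shape μ (split₂ μ k))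
    (cong (ℕ._+ 1) (∸-shape (2 ℕ.* μ) (ℕP.*-distribˡ-+ 2 μ k)))
    where
    multinom-cong : ∀ {N N′ a a′ c c′} b → N ≡ N′ → a ≡ a′ → c ≡ c′ → multinom N a b c ≡ multinom N′ a′ b c′
    multinom-cong b refl refl refl = refl
    split₄ : ∀ μ k → 4 ℕ.* (μ ℕ.+ k) ≡ 2 ℕ.* μ ℕ.+ (2 ℕ.* μ ℕ.+ 4 ℕ.* k)
    split₄ = solve-∀ℕ
    split₂ : ∀ μ k → 2 ℕ.* (μ ℕ.+ k) ≡ μ ℕ.+ (μ ℕ.+ 2 ℕ.* k)
    split₂ = solve-∀ℕ

  module _ (m k : ℕ) where
    private
      M K : ℚ
      M = fromℕ m
      K = fromℕ k

    W : ℚ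
    W = multinom (3 ℕ.+ (2 ℕ.* m ℕ.+ 4 ℕ.* k)) (3 ℕ.+ (m ℕ.+ 2 ℕ.* k)) (suc m) (3 ℕ.+ 2 ℕ.* k)

    coeff[1+m+k,1+m] : let e = M + 2 * K in
      coeff (suc m ℕ.+ k) (suc m) ≡ (2 + e) * ((3 + e) * ((2 + 2 * K) * ((3 + 2 * K) * W)))
    coeff[1+m+k,1+m] = trans (coeff-shape (suc m) k refl (N-eq m k) refl (ℕP.+-comm (2 ℕ.* k) 1))
      ( multinom-suc₁ N (1 ℕ.+ a) (suc m) (1 ℕ.+ c) ∙⟨ ⌜ 2 ⌝ ⊕ (⌜ m ⌝ ⊕ ⌜ 2 ⌝ ⊗ ⌜ k ⌝) ⟩
        multinom-suc₁ N (2 ℕ.+ a) (suc m) (1 ℕ.+ c) ∙⟨ ⌜ 3 ⌝ ⊕ (⌜ m ⌝ ⊕ ⌜ 2 ⌝ ⊗ ⌜ k ⌝) ⟩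
        multinom-suc₃ N (3 ℕ.+ a) (suc m) (1 ℕ.+ c) ∙⟨ ⌜ 2 ⌝ ⊕ ⌜ 2 ⌝ ⊗ ⌜ k ⌝ ⟩
        multinom-suc₃ N (3 ℕ.+ a) (suc m) (2 ℕ.+ c) ∙⟨ ⌜ 3 ⌝ ⊕ ⌜ 2 ⌝ ⊗ ⌜ k ⌝ ⟩
        refl )
      where
      N = 3 ℕ.+ (2 ℕ.* m ℕ.+ 4 ℕ.* k)
      a = m ℕ.+ 2 ℕ.* k
      c = 2 ℕ.* k
      N-eq : ∀ m k → 2 ℕ.* suc m ℕ.+ 4 ℕ.* k ℕ.+ 1 ≡ 3 ℕ.+ (2 ℕ.* m ℕ.+ 4 ℕ.* k)
      N-eq = solve-∀ℕ

    coeff[1+m+k,m] : let d = 2 * M + 4 * K ; e = M + 2 * K in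
      coeff (suc m ℕ.+ k) m ≡ (5 + d) * ((4 + d) * ((3 + e) * ((1 + M) * W)))
    coeff[1+m+k,m] = trans (coeff-shape m (suc k) (ℕP.+-suc m k) (N-eq m k) (a-eq m k) (2[1+k]+1≡3+2k k))
      ( multinom-suc (4 ℕ.+ N) (2 ℕ.+ a) m (3 ℕ.+ c)  ∙⟨ ⌜ 5 ⌝ ⊕ (⌜ 2 ⌝ ⊗ ⌜ m ⌝ ⊕ ⌜ 4 ⌝ ⊗ ⌜ k ⌝) ⟩
        multinom-suc (3 ℕ.+ N) (2 ℕ.+ a) m (3 ℕ.+ c)  ∙⟨ ⌜ 4 ⌝ ⊕ (⌜ 2 ⌝ ⊗ ⌜ m ⌝ ⊕ ⌜ 4 ⌝ ⊗ ⌜ k ⌝) ⟩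
        multinom-suc₁ (3 ℕ.+ N) (2 ℕ.+ a) m (3 ℕ.+ c) ∙⟨ ⌜ 3 ⌝ ⊕ (⌜ m ⌝ ⊕ ⌜ 2 ⌝ ⊗ ⌜ k ⌝) ⟩
        multinom-suc₂ (3 ℕ.+ N) (3 ℕ.+ a) m (3 ℕ.+ c) ∙⟨ ⌜ 1 ⌝ ⊕ ⌜ m ⌝ ⟩
        refl )
      where
      N = 2 ℕ.* m ℕ.+ 4 ℕ.* k
      a = m ℕ.+ 2 ℕ.* k
      c = 2 ℕ.* k
      N-eq : ∀ m k → 2 ℕ.* m ℕ.+ 4 ℕ.* suc k ℕ.+ 1 ≡ 5 ℕ.+ (2 ℕ.* m ℕ.+ 4 ℕ.* k)
      N-eq = solve-∀ℕ
      a-eq : ∀ m k → m ℕ.+ 2 ℕ.* suc k ≡ 2 ℕ.+ (m ℕ.+ 2 ℕ.* k)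
      a-eq = solve-∀ℕ

    coeff[2+m+k,1+m] : let d = 2 * M + 4 * K in
      coeff (suc (suc m ℕ.+ k)) (suc m) ≡ (7 + d) * ((6 + d) * ((5 + d) * ((4 + d) * W)))
    coeff[2+m+k,1+m] = trans (coeff-shape (suc m) (suc k) (ℕP.+-suc (suc m) k) (N-eq m k) (a-eq m k) (2[1+k]+1≡3+2k k))
      ( multinom-suc (6 ℕ.+ N) (3 ℕ.+ a) (suc m) (3 ℕ.+ c) ∙⟨ ⌜ 7 ⌝ ⊕ (⌜ 2 ⌝ ⊗ ⌜ m ⌝ ⊕ ⌜ 4 ⌝ ⊗ ⌜ k ⌝) ⟩
        multinom-suc (5 ℕ.+ N) (3 ℕ.+ a) (suc m) (3 ℕ.+ c) ∙⟨ ⌜ 6 ⌝ ⊕ (⌜ 2 ⌝ ⊗ ⌜ m ⌝ ⊕ ⌜ 4 ⌝ ⊗ ⌜ k ⌝) ⟩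
        multinom-suc (4 ℕ.+ N) (3 ℕ.+ a) (suc m) (3 ℕ.+ c) ∙⟨ ⌜ 5 ⌝ ⊕ (⌜ 2 ⌝ ⊗ ⌜ m ⌝ ⊕ ⌜ 4 ⌝ ⊗ ⌜ k ⌝) ⟩
        multinom-suc (3 ℕ.+ N) (3 ℕ.+ a) (suc m) (3 ℕ.+ c) ∙⟨ ⌜ 4 ⌝ ⊕ (⌜ 2 ⌝ ⊗ ⌜ m ⌝ ⊕ ⌜ 4 ⌝ ⊗ ⌜ k ⌝) ⟩
        refl )
      where
      N = 2 ℕ.* m ℕ.+ 4 ℕ.* k
      a = m ℕ.+ 2 ℕ.* k
      c = 2 ℕ.* k
      N-eq : ∀ m k → 2 ℕ.* suc m ℕ.+ 4 ℕ.* suc k ℕ.+ 1 ≡ 7 ℕ.+ (2 ℕ.* m ℕ.+ 4 ℕ.* k)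
      N-eq = solve-∀ℕ
      a-eq : ∀ m k → suc m ℕ.+ 2 ℕ.* suc k ≡ 3 ℕ.+ (m ℕ.+ 2 ℕ.* k)
      a-eq = solve-∀ℕ

  -- The recurrence in j

  c₀ c₁ P Q : ℚ → ℚ → ℚ
  c₀ n J = - ((n - J + 1) * (2 * n - 2 * J + 1))
  c₁ n J = - ((2 * J + 1) * (2 * n - J + 1))
  P n M = (2 * n - 2 * M + 1) * (n - M)
  Q n M = M * (4 * n - 2 * M + 3)

  certificate-identity : ∀ n J M X Y → X * (2 * (M - J) + 1) ≡ 2 → Y * (2 * (M - (1 + J)) + 1) ≡ 2 →
                         c₀ n J * X + c₁ n J * Y ≡ - (P n M * X + Q n M * Y)
  certificate-identity n J M X Y hX hY = begin
    c₀ n J * X + c₁ n J * Y                      ≡⟨ expand n J M X Y ⟩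
    R + L * (X * (2 * (M - J) + 1) - Y * (2 * (M - (1 + J)) + 1))
                                                 ≡⟨ cong (λ d → R + L * d) (cong₂ _-_ hX hY) ⟩
    R + L * 0ℚ                                   ≡⟨ cong (_+_ R) (ℚP.*-zeroʳ L) ⟩
    R + 0ℚ                                       ≡⟨ ℚP.+-identityʳ R ⟩
    R                                            ∎
    where
    open ≡-Reasoning
    R = - (P n M * X + Q n M * Y)
    L = M + J - 2 * n - 1
    expand : ∀ n J M X Y →
      - ((n - J + 1) * (2 * n - 2 * J + 1)) * X + - ((2 * J + 1) * (2 * n - J + 1)) * Y
      ≡ - ((2 * n - 2 * M + 1) * (n - M) * X + M * (4 * n - 2 * M + 3) * Y)
        + (M + J - 2 * n - 1) * (X * (2 * (M - J) + 1) - Y * (2 * (M - (1 + J)) + 1))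
    expand = solve-∀ ℚ-ring

  coeff-P≡coeff-Q : ∀ m k → coeff (suc m ℕ.+ k) m * P (fromℕ (suc m ℕ.+ k)) (fromℕ m)
                          ≡ coeff (suc m ℕ.+ k) (suc m) * Q (fromℕ (suc m ℕ.+ k)) (fromℕ (suc m))
  coeff-P≡coeff-Q m k =
    trans (cong₂ (λ c n → c * P n (fromℕ m)) (coeff[1+m+k,m] m k) ν≡)
          (trans (ratio (fromℕ m) (fromℕ k) (W m k))
                 (sym (cong₃ (λ c n M → c * Q n M) (coeff[1+m+k,1+m] m k) ν≡ (fromℕ-suc m))))
    where
    ν≡ = fromℕ-⟦⟧ (⌜ 1 ⌝ ⊕ ⌜ m ⌝ ⊕ ⌜ k ⌝)
    ratio : ∀ M K W → let n = 1 + M + K ; d = 2 * M + 4 * K ; e = M + 2 * K in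
      (5 + d) * ((4 + d) * ((3 + e) * ((1 + M) * W))) * ((2 * n - 2 * M + 1) * (n - M))
      ≡ (2 + e) * ((3 + e) * ((2 + 2 * K) * ((3 + 2 * K) * W))) * ((1 + M) * (4 * n - 2 * (1 + M) + 3))
    ratio = solve-∀ ℚ-ring

  j-certificate : ℕ → ℕ → ℕ → ℚ
  j-certificate ν j m = - (signℚ m * coeff ν m * P (fromℕ ν) (fromℕ m) * recipHalfShift (+ m ℤ.- + j))

  j-telescoping-start : ∀ ν j → c₀ (fromℕ ν) (fromℕ j) * summand ν j 0 + c₁ (fromℕ ν) (fromℕ j) * summand ν (suc j) 0
                                ≡ j-certificate ν j 0
  j-telescoping-start ν j = begin
    a * (1ℚ * X * A) + b * (1ℚ * Y * A)   ≡⟨ factor a b X Y A ⟩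
    A * (a * X + b * Y)                   ≡⟨ cong (A *_) (certificate-identity n J 0 X Y hX hY) ⟩
    A * - (P n 0 * X + Q n 0 * Y)         ≡⟨ Q₀ A (P n 0) X n Y ⟩
    j-certificate ν j 0                   ∎
    where
    open ≡-Reasoning
    n = fromℕ ν
    J = fromℕ j
    a = c₀ n J
    b = c₁ n J
    A = coeff ν 0
    X = recipHalfShift (+ 0 ℤ.- + j)
    Y = recipHalfShift (+ 0 ℤ.- + suc j)
    hX = recipHalfShift-diff 0 j
    hY = recipHalfShift-diff-suc 0 j
    factor : ∀ a b X Y A → a * (1 * X * A) + b * (1 * Y * A) ≡ A * (a * X + b * Y)
    factor = solve-∀ ℚ-ring
    Q₀ : ∀ A p X n Y → A * - (p * X + 0 * (4 * n - 2 * 0 + 3) * Y) ≡ - (1 * A * p * X)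
    Q₀ = solve-∀ ℚ-ring

  j-telescoping-step : ∀ {ν} j m k → suc m ℕ.+ k ≡ ν →
    c₀ (fromℕ ν) (fromℕ j) * summand ν j (suc m) + c₁ (fromℕ ν) (fromℕ j) * summand ν (suc j) (suc m)
    ≡ j-certificate ν j (suc m) - j-certificate ν j m
  j-telescoping-step {ν} j m k refl = begin
    a * (- s * X * A′) + b * (- s * Y′ * A′)                 ≡⟨ factor a b s X Y′ A′ ⟩
    - s * A′ * (a * X + b * Y′)                              ≡⟨ cong (- s * A′ *_) (certificate-identity n J M′ X Y′ hX hY) ⟩
    - s * A′ * - (P n M′ * X + Q n M′ * Y′)                  ≡⟨ distribute s A′ (P n M′) X (Q n M′) Y′ ⟩
    - (- s * A′ * P n M′ * X) - - (s * (A′ * Q n M′) * Y′)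
        ≡⟨ cong₂ (λ c y → - (- s * A′ * P n M′ * X) - - (s * c * y)) (coeff-P≡coeff-Q m k) (sym (recipHalfShift-shift m j)) ⟨
    - (- s * A′ * P n M′ * X) - - (s * (A * P n M) * Y)     ≡⟨ cong (λ z → - (- s * A′ * P n M′ * X) - - (z * Y)) (ℚP.*-assoc s A (P n M)) ⟨
    j-certificate ν j (suc m) - j-certificate ν j m          ∎
    where
    open ≡-Reasoning
    n = fromℕ ν
    J = fromℕ j
    M = fromℕ m
    M′ = fromℕ (suc m)
    a = c₀ n J
    b = c₁ n J
    s = signℚ m
    A = coeff ν m
    A′ = coeff ν (suc m)
    X = recipHalfShift (+ suc m ℤ.- + j)
    Y = recipHalfShift (+ m ℤ.- + j)
    Y′ = recipHalfShift (+ suc m ℤ.- + suc j)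
    hX = recipHalfShift-diff (suc m) j
    hY = recipHalfShift-diff-suc (suc m) j
    factor : ∀ a b s X Y A → a * (- s * X * A) + b * (- s * Y * A) ≡ - s * A * (a * X + b * Y)
    factor = solve-∀ ℚ-ring
    distribute : ∀ s A p X q Y → - s * A * - (p * X + q * Y) ≡ - (- s * A * p * X) - - (s * (A * q) * Y)
    distribute = solve-∀ ℚ-ring

  lhs-j-recurrence : ∀ ν j → c₀ (fromℕ ν) (fromℕ j) * lhs ν j + c₁ (fromℕ ν) (fromℕ j) * lhs ν (suc j) ≡ 0ℚ
  lhs-j-recurrence ν j = begin
    a * lhs ν j + b * lhs ν (suc j)  ≡⟨ sumTo-linear ν (summand ν j) (summand ν (suc j)) a b ⟨
    sumTo ν (λ μ → a * summand ν j μ + b * summand ν (suc j) μ)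
                                     ≡⟨ sumTo-telescope ν _ (j-certificate ν j) (j-telescoping-start ν j)
                                          (λ m m<ν → j-telescoping-step j m (ν ℕ.∸ suc m) (ℕP.m+[n∸m]≡n m<ν)) ⟩
    j-certificate ν j ν              ≡⟨ P-diagonal (signℚ ν) (coeff ν ν) (fromℕ ν) (recipHalfShift (+ ν ℤ.- + j)) ⟩
    0ℚ                               ∎
    where
    open ≡-Reasoning
    a = c₀ (fromℕ ν) (fromℕ j)
    b = c₁ (fromℕ ν) (fromℕ j)
    P-diagonal : ∀ s A n X → - (s * A * ((2 * n - 2 * n + 1) * (n - n)) * X) ≡ 0
    P-diagonal = solve-∀ ℚ-ring

  recipFact-negative : ∀ {x y} → x ℕ.< y → recipFact (+ x ℤ.- + y) ≡ 0ℚ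
  recipFact-negative {x} {y} x<y =
    subst (λ y → recipFact (+ x ℤ.- + y) ≡ 0ℚ) (ℕP.m+[n∸m]≡n x<y) (cong recipFact (below (y ℕ.∸ suc x)))
    where
    open ≡-Reasoning
    below : ∀ d → + x ℤ.- + (suc x ℕ.+ d) ≡ -[1+ d ]
    below d = begin
      + x ℤ.- + (suc x ℕ.+ d)      ≡⟨ ℤP.m-n≡m⊖n x (suc x ℕ.+ d) ⟩
      x ℤ.⊖ (suc x ℕ.+ d)          ≡⟨ ℤP.⊖-< (ℕP.m≤m+n (suc x) d) ⟩
      ℤ.- + (suc x ℕ.+ d ℕ.∸ x)    ≡⟨ cong (λ z → ℤ.- + z) (∸-shape x (sym (ℕP.+-suc x d))) ⟩
      -[1+ d ]                     ∎

  rhs-vanishes : ∀ {ν j} → suc ν ℕ.< j → rhs ν j ≡ 0ℚ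
  rhs-vanishes {ν} {j} 1+ν<j = trans (cong (prefactor *_) (recipFact-negative 2ν+2<2j)) (ℚP.*-zeroʳ prefactor)
    where
    prefactor = + (2 ℕ.^ (4 ℕ.* ν ℕ.+ 2)) / 1 * signℚ j * factℚ (2 ℕ.* ν ℕ.∸ j ℕ.+ 1) * factℚ j * recipFact (+ (2 ℕ.* j))
    2ν+2-eq : ∀ ν → 2 ℕ.* suc ν ≡ 2 ℕ.* ν ℕ.+ 2
    2ν+2-eq = solve-∀ℕ
    2ν+2<2j : 2 ℕ.* ν ℕ.+ 2 ℕ.< 2 ℕ.* j
    2ν+2<2j = subst (ℕ._< 2 ℕ.* j) (2ν+2-eq ν) (ℕP.*-monoʳ-< 2 1+ν<j)

  -- 1 ≤ ν is needed only because 2ν ∸ (j+1) is truncated when ν = j = 0.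
  rhs-j-recurrence-below : ∀ {ν} j k → j ℕ.+ k ≡ ν → 1 ≤ ν →
    c₀ (fromℕ ν) (fromℕ j) * rhs ν j + c₁ (fromℕ ν) (fromℕ j) * rhs ν (suc j) ≡ 0ℚ
  rhs-j-recurrence-below {ν} j k refl 1≤ν = begin
    c₀ (fromℕ ν) J * rhs ν j + c₁ (fromℕ ν) J * rhs ν (suc j)
      ≡⟨ cong₃ (λ n x y → c₀ n J * x + c₁ n J * y) (fromℕ-⟦⟧ (⌜ j ⌝ ⊕ ⌜ k ⌝)) rhs-at-j rhs-at-suc-j ⟩
    c₀ (J + K) J * (p * s * ((1 + (J + 2 * K)) * F) * f * ((1 + 2 * J) * ((2 + 2 * J) * r₁)) * r₂)
      + c₁ (J + K) J * (p * - s * F * ((1 + J) * f) * r₁ * ((1 + 2 * K) * ((2 + 2 * K) * r₂)))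
      ≡⟨ cancel p s F f r₁ r₂ J K ⟩
    0ℚ ∎
    where
    open ≡-Reasoning
    J = fromℕ j
    K = fromℕ k
    p = + (2 ℕ.^ (4 ℕ.* ν ℕ.+ 2)) / 1
    s = signℚ j
    F = factℚ (j ℕ.+ 2 ℕ.* k)
    f = factℚ j
    r₁ = recipFact (+ (2 ℕ.+ 2 ℕ.* j))
    r₂ = recipFact (+ (2 ℕ.+ 2 ℕ.* k))
    factors : ∀ σ {a a′ b b′ c c′ d d′} → a ≡ a′ → b ≡ b′ → c ≡ c′ → d ≡ d′ →
              p * σ * a * b * c * d ≡ p * σ * a′ * b′ * c′ * d′
    factors σ refl refl refl refl = refl
    2ν-eq : ∀ j k → 2 ℕ.* (j ℕ.+ k) ≡ j ℕ.+ (j ℕ.+ 2 ℕ.* k)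
    2ν-eq = solve-∀ℕ
    2ν+2-eq : ∀ j k → 2 ℕ.* (j ℕ.+ k) ℕ.+ 2 ≡ 2 ℕ.* j ℕ.+ (2 ℕ.+ 2 ℕ.* k)
    2ν+2-eq = solve-∀ℕ
    2ν+2-eq′ : ∀ j k → 2 ℕ.* (j ℕ.+ k) ℕ.+ 2 ≡ 2 ℕ.* suc j ℕ.+ 2 ℕ.* k
    2ν+2-eq′ = solve-∀ℕ
    1+j≤2ν : suc j ≤ 2 ℕ.* (j ℕ.+ k)
    1+j≤2ν = ℕP.+-mono-≤ 1≤ν (ℕP.≤-trans (ℕP.m≤m+n j k) (ℕP.m≤m+n (j ℕ.+ k) 0))
    rhs-at-j : rhs ν j ≡ p * s * ((1 + (J + 2 * K)) * F) * f * ((1 + 2 * J) * ((2 + 2 * J) * r₁)) * r₂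
    rhs-at-j = factors s
      (trans (cong (λ x → factℚ (x ℕ.+ 1)) (∸-shape j (2ν-eq j k)))
             (trans (cong factℚ (ℕP.+-comm (j ℕ.+ 2 ℕ.* k) 1))
                    (factℚ-suc (j ℕ.+ 2 ℕ.* k) ∙⟨ ⌜ 1 ⌝ ⊕ (⌜ j ⌝ ⊕ ⌜ 2 ⌝ ⊗ ⌜ k ⌝) ⟩ refl)))
      refl
      (recipFact-suc (2 ℕ.* j) ∙⟨ ⌜ 1 ⌝ ⊕ ⌜ 2 ⌝ ⊗ ⌜ j ⌝ ⟩ recipFact-suc (suc (2 ℕ.* j)) ∙⟨ ⌜ 2 ⌝ ⊕ ⌜ 2 ⌝ ⊗ ⌜ j ⌝ ⟩ refl)
      (cong recipFact (ℤ-sub-shape (2 ℕ.* j) (2 ℕ.+ 2 ℕ.* k) (2ν+2-eq j k)))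
    rhs-at-suc-j : rhs ν (suc j) ≡ p * - s * F * ((1 + J) * f) * r₁ * ((1 + 2 * K) * ((2 + 2 * K) * r₂))
    rhs-at-suc-j = factors (- s)
      (cong factℚ (begin
        2 ℕ.* (j ℕ.+ k) ℕ.∸ suc j ℕ.+ 1    ≡⟨ ℕP.+-comm _ 1 ⟩
        1 ℕ.+ (2 ℕ.* (j ℕ.+ k) ℕ.∸ suc j)  ≡⟨ ℕP.+-∸-assoc 1 1+j≤2ν ⟨
        2 ℕ.* (j ℕ.+ k) ℕ.∸ j              ≡⟨ ∸-shape j (2ν-eq j k) ⟩
        j ℕ.+ 2 ℕ.* k                      ∎))
      (factℚ-suc j ∙⟨ ⌜ 1 ⌝ ⊕ ⌜ j ⌝ ⟩ refl)
      (cong (λ x → recipFact (+ x)) (2[1+k]≡2+2k j))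
      (trans (cong recipFact (ℤ-sub-shape (2 ℕ.* suc j) (2 ℕ.* k) (2ν+2-eq′ j k)))
             (recipFact-suc (2 ℕ.* k) ∙⟨ ⌜ 1 ⌝ ⊕ ⌜ 2 ⌝ ⊗ ⌜ k ⌝ ⟩ recipFact-suc (suc (2 ℕ.* k)) ∙⟨ ⌜ 2 ⌝ ⊕ ⌜ 2 ⌝ ⊗ ⌜ k ⌝ ⟩ refl))
    cancel : ∀ p s F f r₁ r₂ J K →
      - ((J + K - J + 1) * (2 * (J + K) - 2 * J + 1))
        * (p * s * ((1 + (J + 2 * K)) * F) * f * ((1 + 2 * J) * ((2 + 2 * J) * r₁)) * r₂)
      + - ((2 * J + 1) * (2 * (J + K) - J + 1))
        * (p * - s * F * ((1 + J) * f) * r₁ * ((1 + 2 * K) * ((2 + 2 * K) * r₂)))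
      ≡ 0
    cancel = solve-∀ ℚ-ring

  rhs-j-recurrence-above : ∀ {ν} j → ν ℕ.< j →
    c₀ (fromℕ ν) (fromℕ j) * rhs ν j + c₁ (fromℕ ν) (fromℕ j) * rhs ν (suc j) ≡ 0ℚ
  rhs-j-recurrence-above {ν} j ν<j with ℕP.m≤n⇒m<n∨m≡n ν<j
  ... | inj₁ 1+ν<j = begin
    a * rhs ν j + b * rhs ν (suc j)   ≡⟨ cong₂ (λ x y → a * x + b * y) (rhs-vanishes 1+ν<j) (rhs-vanishes (ℕP.m<n⇒m<1+n 1+ν<j)) ⟩
    a * 0ℚ + b * 0ℚ                   ≡⟨ zeros a b ⟩
    0ℚ                                ∎
    where
    open ≡-Reasoning
    a = c₀ (fromℕ ν) (fromℕ j)
    b = c₁ (fromℕ ν) (fromℕ j)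
    zeros : ∀ a b → a * 0 + b * 0 ≡ 0
    zeros = solve-∀ ℚ-ring
  ... | inj₂ refl = begin
    c₀ n (fromℕ (suc ν)) * rhs ν (suc ν) + b * rhs ν (suc (suc ν))
                                      ≡⟨ cong₂ (λ J y → c₀ n J * rhs ν (suc ν) + b * y) (fromℕ-suc ν) (rhs-vanishes {ν} ℕP.≤-refl) ⟩
    c₀ n (1 + n) * rhs ν (suc ν) + b * 0ℚ
                                      ≡⟨ c₀-vanishes n (rhs ν (suc ν)) b ⟩
    0ℚ                                ∎
    where
    open ≡-Reasoning
    n = fromℕ ν
    b = c₁ n (fromℕ (suc ν))
    c₀-vanishes : ∀ n x b → - ((n - (1 + n) + 1) * (2 * n - 2 * (1 + n) + 1)) * x + b * 0 ≡ 0
    c₀-vanishes = solve-∀ ℚ-ring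

  rhs-j-recurrence : ∀ ν j → 1 ≤ ν →
    c₀ (fromℕ ν) (fromℕ j) * rhs ν j + c₁ (fromℕ ν) (fromℕ j) * rhs ν (suc j) ≡ 0ℚ
  rhs-j-recurrence ν j 1≤ν with j ℕP.≤? ν
  ... | yes j≤ν = rhs-j-recurrence-below j (ν ℕ.∸ j) (ℕP.m+[n∸m]≡n j≤ν) 1≤ν
  ... | no  j≰ν = rhs-j-recurrence-above j (ℕP.≰⇒> j≰ν)

  -- The recurrence in ν at j = 0

  module _ (k : ℕ) where
    private
      K : ℚ
      K = fromℕ k

    W₀ : ℚ
    W₀ = multinom (1 ℕ.+ 4 ℕ.* k) (2 ℕ.+ 2 ℕ.* k) 0 (3 ℕ.+ 2 ℕ.* k)

    coeff[k,0] : coeff k 0 ≡ (1 + 2 * K) * ((2 + 2 * K) * ((2 + 2 * K) * ((3 + 2 * K) * W₀)))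
    coeff[k,0] = trans (coeff-shape 0 k refl (ℕP.+-comm (4 ℕ.* k) 1) refl (ℕP.+-comm (2 ℕ.* k) 1))
      ( multinom-suc₁ N c         0 (1 ℕ.+ c) ∙⟨ ⌜ 1 ⌝ ⊕ ⌜ 2 ⌝ ⊗ ⌜ k ⌝ ⟩
        multinom-suc₁ N (1 ℕ.+ c) 0 (1 ℕ.+ c) ∙⟨ ⌜ 2 ⌝ ⊕ ⌜ 2 ⌝ ⊗ ⌜ k ⌝ ⟩
        multinom-suc₃ N (2 ℕ.+ c) 0 (1 ℕ.+ c) ∙⟨ ⌜ 2 ⌝ ⊕ ⌜ 2 ⌝ ⊗ ⌜ k ⌝ ⟩
        multinom-suc₃ N (2 ℕ.+ c) 0 (2 ℕ.+ c) ∙⟨ ⌜ 3 ⌝ ⊕ ⌜ 2 ⌝ ⊗ ⌜ k ⌝ ⟩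
        refl )
      where
      N = 1 ℕ.+ 4 ℕ.* k
      c = 2 ℕ.* k

    coeff[1+k,0] : coeff (suc k) 0 ≡ (5 + 4 * K) * ((4 + 4 * K) * ((3 + 4 * K) * ((2 + 4 * K) * W₀)))
    coeff[1+k,0] = trans (coeff-shape 0 (suc k) refl (N-eq k) (2[1+k]≡2+2k k) (2[1+k]+1≡3+2k k))
      ( multinom-suc (4 ℕ.+ N) a 0 c ∙⟨ ⌜ 5 ⌝ ⊕ ⌜ 4 ⌝ ⊗ ⌜ k ⌝ ⟩
        multinom-suc (3 ℕ.+ N) a 0 c ∙⟨ ⌜ 4 ⌝ ⊕ ⌜ 4 ⌝ ⊗ ⌜ k ⌝ ⟩
        multinom-suc (2 ℕ.+ N) a 0 c ∙⟨ ⌜ 3 ⌝ ⊕ ⌜ 4 ⌝ ⊗ ⌜ k ⌝ ⟩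
        multinom-suc (1 ℕ.+ N) a 0 c ∙⟨ ⌜ 2 ⌝ ⊕ ⌜ 4 ⌝ ⊗ ⌜ k ⌝ ⟩
        refl )
      where
      N = 4 ℕ.* k
      a = 2 ℕ.+ 2 ℕ.* k
      c = 3 ℕ.+ 2 ℕ.* k
      N-eq : ∀ k → 4 ℕ.* suc k ℕ.+ 1 ≡ 5 ℕ.+ 4 ℕ.* k
      N-eq = solve-∀ℕ

  module _ (ν : ℕ) where
    private
      n : ℚ
      n = fromℕ ν

    W₁ : ℚ
    W₁ = multinom (1 ℕ.+ 2 ℕ.* ν) (suc ν) (suc ν) 1

    coeff[ν,ν] : coeff ν ν ≡ (1 + n) * ((1 + n) * W₁)
    coeff[ν,ν] = trans (coeff-shape ν 0 (ℕP.+-identityʳ ν) (N-eq ν) (ℕP.+-identityʳ ν) refl)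
      ( multinom-suc₁ (1 ℕ.+ 2 ℕ.* ν) ν       ν 1 ∙⟨ ⌜ 1 ⌝ ⊕ ⌜ ν ⌝ ⟩
        multinom-suc₂ (1 ℕ.+ 2 ℕ.* ν) (suc ν) ν 1 ∙⟨ ⌜ 1 ⌝ ⊕ ⌜ ν ⌝ ⟩
        refl )
      where
      N-eq : ∀ ν → 2 ℕ.* ν ℕ.+ 4 ℕ.* 0 ℕ.+ 1 ≡ 1 ℕ.+ 2 ℕ.* ν
      N-eq = solve-∀ℕ

    coeff[1+ν,1+ν] : coeff (suc ν) (suc ν) ≡ (3 + 2 * n) * ((2 + 2 * n) * W₁)
    coeff[1+ν,1+ν] = trans (coeff-shape (suc ν) 0 (ℕP.+-identityʳ (suc ν)) (N-eq ν) (ℕP.+-identityʳ (suc ν)) refl)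
      ( multinom-suc (2 ℕ.+ 2 ℕ.* ν) (suc ν) (suc ν) 1 ∙⟨ ⌜ 3 ⌝ ⊕ ⌜ 2 ⌝ ⊗ ⌜ ν ⌝ ⟩
        multinom-suc (1 ℕ.+ 2 ℕ.* ν) (suc ν) (suc ν) 1 ∙⟨ ⌜ 2 ⌝ ⊕ ⌜ 2 ⌝ ⊗ ⌜ ν ⌝ ⟩
        refl )
      where
      N-eq : ∀ ν → 2 ℕ.* suc ν ℕ.+ 4 ℕ.* 0 ℕ.+ 1 ≡ 3 ℕ.+ 2 ℕ.* ν
      N-eq = solve-∀ℕ

  Λ : ℚ → ℚ
  Λ n = (2 * n + 3) * (n + 1)

  κ : ℚ → ℚ → ℚ
  κ n M = 2 * (8 * n * n + 15 * n + 6) - 4 * (3 * n + 4) * M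

  coeff-ν-start : ∀ k → let n = fromℕ k in
    Λ n * ((n + 2) * coeff (suc k) 0 - 16 * (n + 1) * coeff k 0) ≡ coeff k 0 * κ n 0
  coeff-ν-start k = begin
    Λ K * ((K + 2) * coeff (suc k) 0 - 16 * (K + 1) * coeff k 0)
      ≡⟨ cong₂ (λ a a′ → Λ K * ((K + 2) * a′ - 16 * (K + 1) * a)) (coeff[k,0] k) (coeff[1+k,0] k) ⟩
    Λ K * ((K + 2) * ((5 + 4 * K) * ((4 + 4 * K) * ((3 + 4 * K) * ((2 + 4 * K) * W₀ k))))
           - 16 * (K + 1) * ((1 + 2 * K) * ((2 + 2 * K) * ((2 + 2 * K) * ((3 + 2 * K) * W₀ k)))))
      ≡⟨ identity K (W₀ k) ⟩
    (1 + 2 * K) * ((2 + 2 * K) * ((2 + 2 * K) * ((3 + 2 * K) * W₀ k))) * κ K 0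
      ≡⟨ cong (_* κ K 0) (coeff[k,0] k) ⟨
    coeff k 0 * κ K 0 ∎
    where
    open ≡-Reasoning
    K = fromℕ k
    identity : ∀ K W →
      (2 * K + 3) * (K + 1) * ((K + 2) * ((5 + 4 * K) * ((4 + 4 * K) * ((3 + 4 * K) * ((2 + 4 * K) * W))))
                               - 16 * (K + 1) * ((1 + 2 * K) * ((2 + 2 * K) * ((2 + 2 * K) * ((3 + 2 * K) * W)))))
      ≡ (1 + 2 * K) * ((2 + 2 * K) * ((2 + 2 * K) * ((3 + 2 * K) * W)))
        * (2 * (8 * K * K + 15 * K + 6) - 4 * (3 * K + 4) * 0)
    identity = solve-∀ ℚ-ring

  coeff-ν-step : ∀ m k → let ν = suc m ℕ.+ k ; n = fromℕ ν ; M = fromℕ m in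
    Λ n * ((n + 2) * coeff (suc ν) (suc m) - 16 * (n + 1) * coeff ν (suc m))
      ≡ (2 * (1 + M) + 1) * (coeff ν (suc m) * κ n (1 + M) + coeff ν m * κ n M)
  coeff-ν-step m k = begin
    Λ n * ((n + 2) * coeff (suc ν) (suc m) - 16 * (n + 1) * coeff ν (suc m))
      ≡⟨ cong₃ (λ n a b → Λ n * ((n + 2) * a - 16 * (n + 1) * b)) n≡ (coeff[2+m+k,1+m] m k) (coeff[1+m+k,1+m] m k) ⟩
    _ ≡⟨ identity (fromℕ m) (fromℕ k) (W m k) ⟩
    _ ≡⟨ cong₃ (λ n a b → (2 * (1 + M) + 1) * (a * κ n (1 + M) + b * κ n M)) n≡ (coeff[1+m+k,1+m] m k) (coeff[1+m+k,m] m k) ⟨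
    (2 * (1 + M) + 1) * (coeff ν (suc m) * κ n (1 + M) + coeff ν m * κ n M) ∎
    where
    open ≡-Reasoning
    ν = suc m ℕ.+ k
    n = fromℕ ν
    M = fromℕ m
    n≡ = fromℕ-⟦⟧ (⌜ 1 ⌝ ⊕ ⌜ m ⌝ ⊕ ⌜ k ⌝)
    identity : ∀ M K W →
      let n = 1 + M + K ; d = 2 * M + 4 * K ; e = M + 2 * K
          κ = λ M → 2 * (8 * n * n + 15 * n + 6) - 4 * (3 * n + 4) * M in
      (2 * n + 3) * (n + 1) * ((n + 2) * ((7 + d) * ((6 + d) * ((5 + d) * ((4 + d) * W))))
                               - 16 * (n + 1) * ((2 + e) * ((3 + e) * ((2 + 2 * K) * ((3 + 2 * K) * W)))))
      ≡ (2 * (1 + M) + 1) * ((2 + e) * ((3 + e) * ((2 + 2 * K) * ((3 + 2 * K) * W))) * κ (1 + M)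
                             + (5 + d) * ((4 + d) * ((3 + e) * ((1 + M) * W))) * κ M)
    identity = solve-∀ ℚ-ring

  coeff-ν-end : ∀ ν → let n = fromℕ ν in coeff ν ν * κ n n ≡ (n + 1) * (n + 2) * coeff (suc ν) (suc ν)
  coeff-ν-end ν = begin
    coeff ν ν * κ n n                              ≡⟨ cong (_* κ n n) (coeff[ν,ν] ν) ⟩
    (1 + n) * ((1 + n) * W₁ ν) * κ n n             ≡⟨ identity n (W₁ ν) ⟩
    (n + 1) * (n + 2) * ((3 + 2 * n) * ((2 + 2 * n) * W₁ ν)) ≡⟨ cong ((n + 1) * (n + 2) *_) (coeff[1+ν,1+ν] ν) ⟨
    (n + 1) * (n + 2) * coeff (suc ν) (suc ν)      ∎
    where
    open ≡-Reasoning
    n = fromℕ ν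
    identity : ∀ n W → (1 + n) * ((1 + n) * W) * (2 * (8 * n * n + 15 * n + 6) - 4 * (3 * n + 4) * n)
                       ≡ (n + 1) * (n + 2) * ((3 + 2 * n) * ((2 + 2 * n) * W))
    identity = solve-∀ ℚ-ring

  -- The ν-recurrence is telescoped after multiplication by Λ n, which keeps its certificate polynomial.
  ν-combination : ℕ → ℕ → ℚ
  ν-combination ν m = Λ n * (n + 2) * summand (suc ν) 0 m + - (Λ n * (16 * (n + 1))) * summand ν 0 m
    where n = fromℕ ν

  ν-certificate : ℕ → ℕ → ℚ
  ν-certificate ν m = 2 * signℚ m * coeff ν m * κ (fromℕ ν) (fromℕ m)

  ν-telescoping-start : ∀ ν → ν-combination ν 0 ≡ ν-certificate ν 0
  ν-telescoping-start ν = begin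
    L * (n + 2) * (1 * 2 * A′) + - (L * (16 * (n + 1))) * (1 * 2 * A) ≡⟨ pull-2 L n A′ A ⟩
    2 * (L * ((n + 2) * A′ - 16 * (n + 1) * A))                         ≡⟨ cong (2 *_) (coeff-ν-start ν) ⟩
    2 * (A * κ n 0)                                                     ≡⟨ ℚP.*-assoc 2 A (κ n 0) ⟨
    2 * 1 * A * κ n 0                                                   ∎
    where
    open ≡-Reasoning
    n = fromℕ ν
    L = Λ n
    A = coeff ν 0
    A′ = coeff (suc ν) 0
    pull-2 : ∀ L n a′ a → L * (n + 2) * (1 * 2 * a′) + - (L * (16 * (n + 1))) * (1 * 2 * a)
                          ≡ 2 * (L * ((n + 2) * a′ - 16 * (n + 1) * a))
    pull-2 = solve-∀ ℚ-ring

  ν-telescoping-step : ∀ {ν} m k → suc m ℕ.+ k ≡ ν → ν-combination ν (suc m) ≡ ν-certificate ν (suc m) - ν-certificate ν m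
  ν-telescoping-step {ν} m k refl = begin
    L * (n + 2) * (- s * X * A′) + - (L * (16 * (n + 1))) * (- s * X * Aₗ)
                                                           ≡⟨ pull L n s X A′ Aₗ ⟩
    - s * X * (L * ((n + 2) * A′ - 16 * (n + 1) * Aₗ))     ≡⟨ cong (- s * X *_) (coeff-ν-step m k) ⟩
    - s * X * ((2 * (1 + M) + 1) * Φ)                      ≡⟨ regroup (- s) X (2 * (1 + M) + 1) Φ ⟩
    - s * (X * (2 * (1 + M) + 1)) * Φ                      ≡⟨ cong (λ x → - s * x * Φ) (recipHalfShift-suc m) ⟩
    - s * 2 * Φ                                            ≡⟨ expand s Aₗ (κ n (1 + M)) A (κ n M) ⟩
    2 * - s * Aₗ * κ n (1 + M) - 2 * s * A * κ n M         ≡⟨ cong (λ x → 2 * - s * Aₗ * κ n x - 2 * s * A * κ n M) (fromℕ-suc m) ⟨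
    ν-certificate ν (suc m) - ν-certificate ν m            ∎
    where
    open ≡-Reasoning
    n = fromℕ (suc m ℕ.+ k)
    M = fromℕ m
    L = Λ n
    s = signℚ m
    X = recipHalfShift (+ suc m ℤ.- + 0)
    A = coeff (suc m ℕ.+ k) m
    Aₗ = coeff (suc m ℕ.+ k) (suc m)
    A′ = coeff (suc (suc m ℕ.+ k)) (suc m)
    Φ = Aₗ * κ n (1 + M) + A * κ n M
    pull : ∀ L n s X a′ a → L * (n + 2) * (- s * X * a′) + - (L * (16 * (n + 1))) * (- s * X * a)
                            ≡ - s * X * (L * ((n + 2) * a′ - 16 * (n + 1) * a))
    pull = solve-∀ ℚ-ring
    regroup : ∀ t X c Φ → t * X * (c * Φ) ≡ t * (X * c) * Φ
    regroup = solve-∀ ℚ-ring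
    expand : ∀ s a k a′ k′ → - s * 2 * (a * k + a′ * k′) ≡ 2 * - s * a * k - 2 * s * a′ * k′
    expand = solve-∀ ℚ-ring

  ν-certificate-end : ∀ ν → ν-certificate ν ν ≡ - (Λ (fromℕ ν) * (fromℕ ν + 2) * summand (suc ν) 0 (suc ν))
  ν-certificate-end ν = sym (begin
    - (Λ n * (n + 2) * (- s * X * A′))                ≡⟨ expand s X n A′ ⟩
    s * (X * (2 * (1 + n) + 1)) * ((n + 1) * (n + 2) * A′)
                                                      ≡⟨ cong₂ (λ x y → s * x * y) (recipHalfShift-suc ν) (sym (coeff-ν-end ν)) ⟩
    s * 2 * (A * κ n n)                               ≡⟨ regroup s A (κ n n) ⟩
    2 * s * A * κ n n                                 ∎)
    where
    open ≡-Reasoning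
    n = fromℕ ν
    s = signℚ ν
    X = recipHalfShift (+ suc ν ℤ.- + 0)
    A = coeff ν ν
    A′ = coeff (suc ν) (suc ν)
    expand : ∀ s X n a → - ((2 * n + 3) * (n + 1) * (n + 2) * (- s * X * a)) ≡ s * (X * (2 * (1 + n) + 1)) * ((n + 1) * (n + 2) * a)
    expand = solve-∀ ℚ-ring
    regroup : ∀ s a k → s * 2 * (a * k) ≡ 2 * s * a * k
    regroup = solve-∀ ℚ-ring

  Λ-cancel : ∀ ν {x y} → Λ (fromℕ ν) * x ≡ Λ (fromℕ ν) * y → x ≡ y
  Λ-cancel ν {x} {y} eq = fromℕ-suc-cancelˡ ν (fromℕ-suc-cancelˡ (2 ℕ.+ 2 ℕ.* ν)
    (trans (factorise x) (trans eq (sym (factorise y)))))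
    where
    factorise : ∀ z → fromℕ (3 ℕ.+ 2 ℕ.* ν) * (fromℕ (suc ν) * z) ≡ Λ (fromℕ ν) * z
    factorise z = trans (cong₂ (λ a b → a * (b * z)) (fromℕ-⟦⟧ (⌜ 3 ⌝ ⊕ ⌜ 2 ⌝ ⊗ ⌜ ν ⌝)) (fromℕ-suc ν))
                        (regroup (fromℕ ν) z)
      where
      regroup : ∀ n z → (3 + 2 * n) * ((1 + n) * z) ≡ (2 * n + 3) * (n + 1) * z
      regroup = solve-∀ ℚ-ring

  lhs-ν-recurrence : ∀ ν → (fromℕ ν + 2) * lhs (suc ν) 0 ≡ 16 * (fromℕ ν + 1) * lhs ν 0
  lhs-ν-recurrence ν = Λ-cancel ν (begin
    L * ((n + 2) * (T + t))                                                        ≡⟨ split L n T t S ⟩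
    (L * (n + 2) * T + - (L * (16 * (n + 1))) * S) + L * (n + 2) * t + L * (16 * (n + 1) * S)
                                                                                   ≡⟨ cong (λ z → z + L * (n + 2) * t + L * (16 * (n + 1) * S)) telescoped ⟩
    ν-certificate ν ν + L * (n + 2) * t + L * (16 * (n + 1) * S)                   ≡⟨ cong (λ z → z + L * (n + 2) * t + L * (16 * (n + 1) * S)) (ν-certificate-end ν) ⟩
    - (L * (n + 2) * t) + L * (n + 2) * t + L * (16 * (n + 1) * S)                 ≡⟨ cancel (L * (n + 2) * t) (L * (16 * (n + 1) * S)) ⟩
    L * (16 * (n + 1) * S)                                                         ∎)
    where
    open ≡-Reasoning
    n = fromℕ ν
    L = Λ n
    T = sumTo ν (summand (suc ν) 0)
    t = summand (suc ν) 0 (suc ν)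
    S = lhs ν 0
    telescoped : L * (n + 2) * T + - (L * (16 * (n + 1))) * S ≡ ν-certificate ν ν
    telescoped = trans (sym (sumTo-linear ν (summand (suc ν) 0) (summand ν 0) (L * (n + 2)) (- (L * (16 * (n + 1))))))
                       (sumTo-telescope ν (ν-combination ν) (ν-certificate ν) (ν-telescoping-start ν)
                         (λ m m<ν → ν-telescoping-step m (ν ℕ.∸ suc m) (ℕP.m+[n∸m]≡n m<ν)))
    split : ∀ L n T t S → L * ((n + 2) * (T + t))
                          ≡ (L * (n + 2) * T + - (L * (16 * (n + 1))) * S) + L * (n + 2) * t + L * (16 * (n + 1) * S)
    split = solve-∀ ℚ-ring
    cancel : ∀ x y → - x + x + y ≡ y
    cancel = solve-∀ ℚ-ring

  rhs-at-0 : ∀ ν → rhs ν 0 ≡ fromℕ (2 ℕ.^ (4 ℕ.* ν ℕ.+ 2)) * factℚ (2 ℕ.* ν ℕ.+ 1) * recipFact (+ (2 ℕ.* ν ℕ.+ 2))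
  rhs-at-0 ν = trans (cong (λ z → p * 1 * f * 1 * 1 * recipFact z) (ℤ-sub-shape 0 (2 ℕ.* ν ℕ.+ 2) refl))
                     (drop-ones p f (recipFact (+ (2 ℕ.* ν ℕ.+ 2))))
    where
    p = fromℕ (2 ℕ.^ (4 ℕ.* ν ℕ.+ 2))
    f = factℚ (2 ℕ.* ν ℕ.+ 1)
    drop-ones : ∀ p f r → p * 1 * f * 1 * 1 * r ≡ p * f * r
    drop-ones = solve-∀ ℚ-ring

  rhs-ν-recurrence : ∀ ν → (fromℕ ν + 2) * rhs (suc ν) 0 ≡ 16 * (fromℕ ν + 1) * rhs ν 0
  rhs-ν-recurrence ν = begin
    (n + 2) * rhs (suc ν) 0
      ≡⟨ cong ((n + 2) *_) (rhs-at-0 (suc ν)) ⟩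
    (n + 2) * (fromℕ (2 ℕ.^ (4 ℕ.* suc ν ℕ.+ 2)) * factℚ (2 ℕ.* suc ν ℕ.+ 1) * recipFact (+ (2 ℕ.* suc ν ℕ.+ 2)))
      ≡⟨ cong₃ (λ p f r → (n + 2) * (p * f * r)) power-eq fact-eq (cong (λ z → recipFact (+ z)) (2ν+4-eq ν)) ⟩
    (n + 2) * (16 * p * ((2 + (2 * n + 1)) * ((1 + (2 * n + 1)) * f)) * r)
      ≡⟨ identity n p f r ⟩
    16 * (n + 1) * (p * f * ((1 + (2 * n + 2)) * ((2 + (2 * n + 2)) * r)))
      ≡⟨ cong (λ z → 16 * (n + 1) * (p * f * z)) recipFact-eq ⟨
    16 * (n + 1) * (p * f * recipFact (+ (2 ℕ.* ν ℕ.+ 2)))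
      ≡⟨ cong (16 * (n + 1) *_) (rhs-at-0 ν) ⟨
    16 * (n + 1) * rhs ν 0 ∎
    where
    open ≡-Reasoning
    n = fromℕ ν
    p = fromℕ (2 ℕ.^ (4 ℕ.* ν ℕ.+ 2))
    f = factℚ (2 ℕ.* ν ℕ.+ 1)
    r = recipFact (+ (2 ℕ.+ (2 ℕ.* ν ℕ.+ 2)))
    4ν+6-eq : ∀ ν → 4 ℕ.* suc ν ℕ.+ 2 ≡ 4 ℕ.+ (4 ℕ.* ν ℕ.+ 2)
    4ν+6-eq = solve-∀ℕ
    2ν+3-eq : ∀ ν → 2 ℕ.* suc ν ℕ.+ 1 ≡ 2 ℕ.+ (2 ℕ.* ν ℕ.+ 1)
    2ν+3-eq = solve-∀ℕ
    2ν+4-eq : ∀ ν → 2 ℕ.* suc ν ℕ.+ 2 ≡ 2 ℕ.+ (2 ℕ.* ν ℕ.+ 2)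
    2ν+4-eq = solve-∀ℕ
    power-eq : fromℕ (2 ℕ.^ (4 ℕ.* suc ν ℕ.+ 2)) ≡ 16 * p
    power-eq = trans (cong (λ e → fromℕ (2 ℕ.^ e)) (4ν+6-eq ν))
                     (trans (cong fromℕ (ℕP.^-distribˡ-+-* 2 4 (4 ℕ.* ν ℕ.+ 2))) (fromℕ-* 16 (2 ℕ.^ (4 ℕ.* ν ℕ.+ 2))))
    fact-eq : factℚ (2 ℕ.* suc ν ℕ.+ 1) ≡ (2 + (2 * n + 1)) * ((1 + (2 * n + 1)) * f)
    fact-eq = trans (cong factℚ (2ν+3-eq ν))
      ( factℚ-suc (suc (2 ℕ.* ν ℕ.+ 1)) ∙⟨ ⌜ 2 ⌝ ⊕ (⌜ 2 ⌝ ⊗ ⌜ ν ⌝ ⊕ ⌜ 1 ⌝) ⟩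
        factℚ-suc (2 ℕ.* ν ℕ.+ 1)       ∙⟨ ⌜ 1 ⌝ ⊕ (⌜ 2 ⌝ ⊗ ⌜ ν ⌝ ⊕ ⌜ 1 ⌝) ⟩
        refl )
    recipFact-eq : recipFact (+ (2 ℕ.* ν ℕ.+ 2)) ≡ (1 + (2 * n + 2)) * ((2 + (2 * n + 2)) * r)
    recipFact-eq =
      recipFact-suc (2 ℕ.* ν ℕ.+ 2)       ∙⟨ ⌜ 1 ⌝ ⊕ (⌜ 2 ⌝ ⊗ ⌜ ν ⌝ ⊕ ⌜ 2 ⌝) ⟩
      recipFact-suc (suc (2 ℕ.* ν ℕ.+ 2)) ∙⟨ ⌜ 2 ⌝ ⊕ (⌜ 2 ⌝ ⊗ ⌜ ν ⌝ ⊕ ⌜ 2 ⌝) ⟩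
      refl
    identity : ∀ n p f r → (n + 2) * (16 * p * ((2 + (2 * n + 1)) * ((1 + (2 * n + 1)) * f)) * r)
                           ≡ 16 * (n + 1) * (p * f * ((1 + (2 * n + 2)) * ((2 + (2 * n + 2)) * r)))
    identity = solve-∀ ℚ-ring

  lhs≡rhs-at-0 : ∀ ν → lhs ν 0 ≡ rhs ν 0
  lhs≡rhs-at-0 zero    = refl
  lhs≡rhs-at-0 (suc ν) = fromℕ-suc-cancelˡ (suc ν) (begin
    fromℕ (2 ℕ.+ ν) * lhs (suc ν) 0   ≡⟨ cong (_* lhs (suc ν) 0) ν+2 ⟩
    (n + 2) * lhs (suc ν) 0           ≡⟨ lhs-ν-recurrence ν ⟩
    16 * (n + 1) * lhs ν 0            ≡⟨ cong (16 * (n + 1) *_) (lhs≡rhs-at-0 ν) ⟩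
    16 * (n + 1) * rhs ν 0            ≡⟨ rhs-ν-recurrence ν ⟨
    (n + 2) * rhs (suc ν) 0           ≡⟨ cong (_* rhs (suc ν) 0) ν+2 ⟨
    fromℕ (2 ℕ.+ ν) * rhs (suc ν) 0   ∎)
    where
    open ≡-Reasoning
    n = fromℕ ν
    ν+2 : fromℕ (2 ℕ.+ ν) ≡ n + 2
    ν+2 = trans (fromℕ-+ 2 ν) (ℚP.+-comm 2 n)

  c₁-factorised : ∀ ν j → j ≤ 2 ℕ.* ν →
                  c₁ (fromℕ ν) (fromℕ j) ≡ - (fromℕ (suc (2 ℕ.* j)) * fromℕ (suc (2 ℕ.* ν ℕ.∸ j)))
  c₁-factorised ν j j≤2ν = begin
    - ((2 * J + 1) * (2 * n - J + 1))           ≡⟨ cong (λ x → - ((2 * J + 1) * (x - J + 1))) D+J≡2n ⟨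
    - ((2 * J + 1) * (D + J - J + 1))           ≡⟨ simplify J D ⟩
    - ((2 * J + 1) * (1 + D))                   ≡⟨ cong₂ (λ a b → - (a * b)) (fromℕ-odd j) (fromℕ-suc (2 ℕ.* ν ℕ.∸ j)) ⟨
    - (fromℕ (suc (2 ℕ.* j)) * fromℕ (suc (2 ℕ.* ν ℕ.∸ j))) ∎
    where
    open ≡-Reasoning
    n = fromℕ ν
    J = fromℕ j
    D = fromℕ (2 ℕ.* ν ℕ.∸ j)
    D+J≡2n : D + J ≡ 2 * n
    D+J≡2n = trans (sym (fromℕ-+ (2 ℕ.* ν ℕ.∸ j) j)) (trans (cong fromℕ (ℕP.m∸n+n≡m j≤2ν)) (fromℕ-* 2 ν))
    simplify : ∀ J D → - ((2 * J + 1) * (D + J - J + 1)) ≡ - ((2 * J + 1) * (1 + D))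
    simplify = solve-∀ ℚ-ring

  neg-fromℕ-suc-cancelˡ : ∀ p q {y y′} → - (fromℕ (suc p) * fromℕ (suc q)) * y ≡ - (fromℕ (suc p) * fromℕ (suc q)) * y′ → y ≡ y′
  neg-fromℕ-suc-cancelˡ p q {y} {y′} eq =
    fromℕ-suc-cancelˡ q (fromℕ-suc-cancelˡ p (ℚP.neg-injective (trans (regroup u v y) (trans eq (sym (regroup u v y′))))))
    where
    u = fromℕ (suc p)
    v = fromℕ (suc q)
    regroup : ∀ u v y → - (u * (v * y)) ≡ - (u * v) * y
    regroup = solve-∀ ℚ-ring

  second-term-determined : ∀ a b x {y y′} → a * x + b * y ≡ 0ℚ → a * x + b * y′ ≡ 0ℚ → b * y ≡ b * y′
  second-term-determined a b x {y} {y′} eq eq′ = +-cancelˡ (a * x) (b * y) (b * y′) (trans eq (sym eq′))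

  lhs≡rhs : ∀ ν j → 1 ≤ ν → j ≤ 2 ℕ.* ν ℕ.+ 1 → lhs ν j ≡ rhs ν j
  lhs≡rhs ν zero    _   _      = lhs≡rhs-at-0 ν
  lhs≡rhs ν (suc j) 1≤ν j<2ν+1 = neg-fromℕ-suc-cancelˡ (2 ℕ.* j) (2 ℕ.* ν ℕ.∸ j) (begin
    - (u * v) * lhs ν (suc j)  ≡⟨ cong (_* lhs ν (suc j)) (c₁-factorised ν j j≤2ν) ⟨
    b * lhs ν (suc j)          ≡⟨ second-term-determined a b (rhs ν j) lhs-recurrence (rhs-j-recurrence ν j 1≤ν) ⟩
    b * rhs ν (suc j)          ≡⟨ cong (_* rhs ν (suc j)) (c₁-factorised ν j j≤2ν) ⟩
    - (u * v) * rhs ν (suc j)  ∎)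
    where
    open ≡-Reasoning
    a = c₀ (fromℕ ν) (fromℕ j)
    b = c₁ (fromℕ ν) (fromℕ j)
    u = fromℕ (suc (2 ℕ.* j))
    v = fromℕ (suc (2 ℕ.* ν ℕ.∸ j))
    j≤2ν : j ≤ 2 ℕ.* ν
    j≤2ν = ℕP.≤-pred (subst (suc j ≤_) (ℕP.+-comm (2 ℕ.* ν) 1) j<2ν+1)
    lhs-recurrence : a * rhs ν j + b * lhs ν (suc j) ≡ 0ℚ
    lhs-recurrence = subst (λ x → a * x + b * lhs ν (suc j) ≡ 0ℚ)
                           (lhs≡rhs ν j 1≤ν (ℕP.<⇒≤ j<2ν+1)) (lhs-j-recurrence ν j)

open import Data.Nat using (_+_; _*_; _∸_; _^_)

lemma4p3 : (ν j : ℕ) → 1 ≤ ν → j ≤ 2 * ν + 1 →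
    sumTo ν (λ μ → signℚ μ ℚ.* recipHalfShift (+ μ ℤ.- + j)
        ℚ.* multinom (4 * ν ∸ 2 * μ + 1) (2 * ν ∸ μ) μ (2 * ν ∸ 2 * μ + 1))
      ≡ (+ (2 ^ (4 * ν + 2))) / 1 ℚ.* signℚ j ℚ.* factℚ (2 * ν ∸ j + 1) ℚ.* factℚ j
          ℚ.* recipFact (+ (2 * j)) ℚ.* recipFact (+ (2 * ν + 2) ℤ.- + (2 * j))
lemma4p3 = lhs≡rhs
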